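{- Let $p \geq 5$ be prime and $A \subseteq \mathbb{Z}_p^2$ with $|A| = 2p+1$. Let $H$ be a subgroup of $\mathbb{Z}_p^2$ of order $p$, with cosets indexed $H_0 = H, H_1, \dots, H_{p-1}$ so that $H_i + H_j = H_{i+j}$ (indices mod $p$), and put $A_i = A \cap H_i$. Assume $|A_0| \geq |A_i|$ for all $i$. Let $m$ be the number of $i \in \{1,\dots,p-1\}$ with $A_i \neq \emptyset$. Suppose $|A_0| \leq \frac{p+1}{2}$ and $m \geq \frac{p+1}{2}$. If $|\hat{2}A| < 4p$, where $\hat{2}A = \{a_1+a_2 \mid a_1,a_2 \in A, a_1 \neq a_2\}$, then $|A_0| = 3$. -}

module Defs where

open import Data.Nat as ℕ using (ℕ; _+_; _∸_; _<?_; NonZero)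
open import Data.Nat.DivMod using (_mod_)
open import Data.Fin as Fin using (Fin; toℕ)
import Data.Fin.Properties as FinP
open import Data.Product using (_×_; _,_)
open import Data.Product.Properties using (≡-dec)
open import Data.List using (List; filter; length; cartesianProduct; allFin)
open import Data.List.Relation.Unary.Any using (any?)
open import Relation.Nullary using (¬?)
open import Relation.Nullary.Decidable using (_×-dec_)
open import Relation.Binary.PropositionalEquality using (_≡_)
open import Relation.Binary.Definitions using (DecidableEquality)

_+p_ : {p : ℕ} .{{_ : NonZero p}} → Fin p → Fin p → Fin p
_+p_ {p} a b = (toℕ a + toℕ b) mod p

G : ℕ → Set
G p = Fin p × Fin p

module _ {p : ℕ} .{{_ : NonZero p}} where

  0G : G p
  0G = (0 mod p , 0 mod p)

  _⊕_ : G p → G p → G p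
  (a , b) ⊕ (c , d) = (a +p c , b +p d)

  ⊖_ : G p → G p
  ⊖ (a , b) = ((p ∸ toℕ a) mod p , (p ∸ toℕ b) mod p)

  allG : List (G p)
  allG = cartesianProduct (allFin p) (allFin p)

  _≟G_ : DecidableEquality (G p)
  _≟G_ = ≡-dec FinP._≟_ FinP._≟_

  -- A_i = A ∩ H_i where H_i = idx⁻¹(i)
  layer : List (G p) → (G p → Fin p) → Fin p → List (G p)
  layer A idx i = filter (λ a → idx a FinP.≟ i) A

  nonemptyCount : List (G p) → (G p → Fin p) → ℕ
  nonemptyCount A idx =
    length (filter (λ i → ¬? (toℕ i ℕ.≟ 0) ×-dec (0 <? length (layer A idx i))) (allFin p))

  -- 2^A = { a₁ + a₂ : a₁,a₂ ∈ A, a₁ ≠ a₂ }, as a duplicate-free list of elements of ℤ_p²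
  restrictedSumset : List (G p) → List (G p)
  restrictedSumset A =
    filter (λ z → any? (λ a₁ → any? (λ a₂ → ¬? (a₁ ≟G a₂) ×-dec ((a₁ ⊕ a₂) ≟G z)) A) A) allG

0F : (p : ℕ) .{{_ : NonZero p}} → Fin p
0F p = 0 mod p

module Submission where

-- Write a = |A₀| and m for the number of nonempty layers A_i, i ≠ 0. Since 2p + 1 = Σ |A_i| ≤ p a, a ≥ 3.
-- Suppose a ≥ 4; then a + 3 ≤ p, and every coset H_i receives many elements of 2̂A:
--   · i = 0: translating A₀ by one of its elements gives a − 1 of them;
--   · i ≠ 0, A_i ≠ ∅: A₀ + A_i lies in H_i, and in ℤ_p² one has |X + Y| ≥ min (p, |X| + |Y| − 1)
--     (Dyson's e-transform, using that every nonzero element has order p), giving |A_i| + 3;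
--   · i ≠ 0, A_i = ∅: the m + 1 > (p + 1)/2 indices of nonempty layers contain j ≠ k with j + k = i, giving 1.
-- Summing, |2̂A| ≥ (a − 1) + (2p + 1 − a) + 3m + (p − 1 − m) = 3p − 1 + 2m ≥ 4p.

open import Defs
open import Data.Nat using (ℕ; _+_; _*_; _≤_; _<_; NonZero)
open import Data.Nat.Primality using (Prime)
open import Data.Fin using (Fin)
open import Data.Product using (_×_; ∃)
open import Data.List using (List; length)
open import Data.List.Membership.Propositional using (_∈_)
open import Data.List.Relation.Unary.Unique.Propositional using (Unique)
open import Relation.Binary.PropositionalEquality using (_≡_)

import Data.Nat as ℕ
open import Data.Nat using (zero; suc; _∸_; _%_; z≤n; s≤s; >-nonZero; >-nonZero⁻¹)
open import Data.Nat.Properties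
open import Data.Nat.DivMod using (_mod_; _/_; %-distribˡ-+; m%n%n≡m%n; m<n⇒m%n≡m; n%n≡0; m≡m%n+[m/n]*n)
open import Data.Nat.Divisibility using (_∣_; divides; >⇒∤)
open import Data.Nat.Primality using (euclidsLemma)
open import Data.Nat.GeneralisedArithmetic using (fold)
open import Data.Nat.Induction using (<-wellFounded)
open import Data.Nat.Solver using (module +-*-Solver)
open import Algebra.Properties.CommutativeSemigroup +-commutativeSemigroup using () renaming (interchange to +-interchange)
open import Data.Fin using (toℕ)
import Data.Fin.Properties as Fin
open import Data.List using ([]; _∷_; _++_; filter; map; allFin; applyUpTo)
open import Data.List.Properties using (length-++; length-map; length-tabulate; length-applyUpTo; filter-none; filter-notAll)
open import Data.List.Membership.Propositional using (find; lose)
open import Data.List.Membership.Propositional.Properties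
open import Data.List.Relation.Unary.All as All using (_∷_)
open import Data.List.Relation.Unary.Any using (here; there)
open import Data.List.Relation.Unary.Unique.Propositional using (_∷_)
import Data.List.Relation.Unary.Unique.Propositional.Properties as Unique
open import Data.List.Relation.Binary.Disjoint.Propositional using (Disjoint)
open import Data.List.Relation.Binary.Subset.Propositional using (_⊆_)
open import Data.Product using (_,_; proj₁; proj₂; ∃₂)
open import Data.Sum using (_⊎_; inj₁; inj₂; map₂)
open import Data.Empty using (⊥-elim)
open import Data.Bool using (if_then_else_)
open import Function using (id)
open import Level using (0ℓ)
open import Algebra.Bundles using (AbelianGroup)
open import Algebra.Structures using (IsAbelianGroup)
open import Algebra.Consequences.Propositional using (comm∧idˡ⇒id; comm∧invˡ⇒inv)
open import Induction.WellFounded using (Acc; acc)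
open import Relation.Nullary using (¬_; Dec; yes; no; does; ¬?)
open import Relation.Nullary.Decidable using (_×-dec_; decidable-stable)
open import Relation.Unary using (Pred; Decidable)
open import Relation.Unary.Properties using (∁?)
open import Relation.Binary.Definitions using (DecidableEquality; tri<; tri≈; tri>)
open import Relation.Binary.PropositionalEquality using (_≢_; ≢-sym; refl; sym; trans; cong; cong₂; subst; subst₂; module ≡-Reasoning)
open import Relation.Binary.PropositionalEquality.Algebra using (isMagma)

module _ {A : Set} where

  Unique-⊆⇒length≤ : {xs ys : List A} → Unique xs → xs ⊆ ys → length xs ≤ length ys
  Unique-⊆⇒length≤ {[]} _ _ = z≤n
  Unique-⊆⇒length≤ {x ∷ xs} (x∉xs ∷ xs!) xs⊆ys with ∈-∃++ (xs⊆ys (here refl))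
  ... | us , vs , refl = subst (length (x ∷ xs) ≤_) (sym length-us++x∷vs) (s≤s (Unique-⊆⇒length≤ xs! xs⊆us++vs))
    where
    length-us++x∷vs : length (us ++ x ∷ vs) ≡ suc (length (us ++ vs))
    length-us++x∷vs = trans (length-++ us) (trans (+-suc _ _) (cong suc (sym (length-++ us))))

    drop-x : ∀ us {z} → z ≢ x → z ∈ us ++ x ∷ vs → z ∈ us ++ vs
    drop-x [] z≢x (here refl) = ⊥-elim (z≢x refl)
    drop-x [] z≢x (there z∈vs) = z∈vs
    drop-x (_ ∷ us) z≢x (here refl) = here refl
    drop-x (_ ∷ us) z≢x (there z∈) = there (drop-x us z≢x z∈)

    xs⊆us++vs : xs ⊆ us ++ vs
    xs⊆us++vs z∈xs = drop-x us (λ { refl → All.lookup x∉xs z∈xs refl }) (xs⊆ys (there z∈xs))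

  Unique-constant⇒length≤1 : {xs : List A} → Unique xs →
                             (∀ {x y} → x ∈ xs → y ∈ xs → x ≡ y) → length xs ≤ 1
  Unique-constant⇒length≤1 {[]} _ _ = z≤n
  Unique-constant⇒length≤1 {_ ∷ []} _ _ = s≤s z≤n
  Unique-constant⇒length≤1 {_ ∷ _ ∷ _} ((x≢y ∷ _) ∷ _) const = ⊥-elim (x≢y (const (here refl) (there (here refl))))

  0<length⇒∃∈ : {xs : List A} → 0 < length xs → ∃ λ x → x ∈ xs
  0<length⇒∃∈ {x ∷ _} _ = x , here refl

  module _ {P : Pred A 0ℓ} (P? : Decidable P) where

    length-filter+length-filter-∁ : ∀ xs → length (filter P? xs) + length (filter (∁? P?) xs) ≡ length xs
    length-filter+length-filter-∁ [] = refl
    length-filter+length-filter-∁ (x ∷ xs) with P? x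
    ... | yes _ = cong suc (length-filter+length-filter-∁ xs)
    ... | no _ = trans (+-suc _ _) (cong suc (length-filter+length-filter-∁ xs))

    length-filter-uniqueWitness : ∀ {xs c} → Unique xs → c ∈ xs → P c → (∀ {x} → P x → x ≡ c) →
                                  length (filter P? xs) ≡ 1
    length-filter-uniqueWitness {x ∷ xs} (x∉xs ∷ xs!) c∈ Pc only with P? x
    ... | yes Px = cong suc (cong length (filter-none P? (All.tabulate ¬P)))
      where
      ¬P : ∀ {y} → y ∈ xs → ¬ P y
      ¬P y∈xs Py = All.lookup x∉xs y∈xs (trans (only Px) (sym (only Py)))
    ... | no ¬Px with c∈
    ...   | here refl = ⊥-elim (¬Px Pc)
    ...   | there c∈xs = length-filter-uniqueWitness xs! c∈xs Pc only

𝟙 : {P : Set} → Dec P → ℕ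
𝟙 P? = if does P? then 1 else 0

∑ : {A : Set} → List A → (A → ℕ) → ℕ
∑ [] f = 0
∑ (x ∷ xs) f = f x + ∑ xs f

syntax ∑ xs (λ x → e) = ∑[ x ∈ xs ] e

module _ {A : Set} where

  ∑-distrib-+ : ∀ (xs : List A) f g → ∑[ x ∈ xs ] (f x + g x) ≡ ∑ xs f + ∑ xs g
  ∑-distrib-+ [] f g = refl
  ∑-distrib-+ (x ∷ xs) f g =
    trans (cong (f x + g x +_) (∑-distrib-+ xs f g)) (+-interchange (f x) (g x) (∑ xs f) (∑ xs g))

  *-distribˡ-∑ : ∀ (xs : List A) c f → ∑[ x ∈ xs ] (c * f x) ≡ c * ∑ xs f
  *-distribˡ-∑ [] c f = sym (*-zeroʳ c)
  *-distribˡ-∑ (x ∷ xs) c f = trans (cong (c * f x +_) (*-distribˡ-∑ xs c f)) (sym (*-distribˡ-+ c (f x) (∑ xs f)))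

  ∑-mono-≤ : ∀ (xs : List A) {f g} → (∀ x → f x ≤ g x) → ∑ xs f ≤ ∑ xs g
  ∑-mono-≤ [] f≤g = z≤n
  ∑-mono-≤ (x ∷ xs) f≤g = +-mono-≤ (f≤g x) (∑-mono-≤ xs f≤g)

  ∑-cong : ∀ (xs : List A) {f g} → (∀ x → f x ≡ g x) → ∑ xs f ≡ ∑ xs g
  ∑-cong [] f≗g = refl
  ∑-cong (x ∷ xs) f≗g = cong₂ _+_ (f≗g x) (∑-cong xs f≗g)

  ∑-const : ∀ (xs : List A) c → ∑[ x ∈ xs ] c ≡ length xs * c
  ∑-const [] c = refl
  ∑-const (x ∷ xs) c = cong (c +_) (∑-const xs c)

  ∑-𝟙≡length-filter : ∀ {P : Pred A 0ℓ} (P? : Decidable P) xs → ∑[ x ∈ xs ] 𝟙 (P? x) ≡ length (filter P? xs)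
  ∑-𝟙≡length-filter P? [] = refl
  ∑-𝟙≡length-filter P? (x ∷ xs) with P? x
  ... | yes _ = cong suc (∑-𝟙≡length-filter P? xs)
  ... | no _ = ∑-𝟙≡length-filter P? xs

  length-filter-∷ : ∀ {P : Pred A 0ℓ} (P? : Decidable P) x xs →
                    length (filter P? (x ∷ xs)) ≡ 𝟙 (P? x) + length (filter P? xs)
  length-filter-∷ P? x xs with P? x
  ... | yes _ = refl
  ... | no _ = refl

module _ {n : ℕ} where

  open import Data.List.Membership.DecPropositional (Fin._≟_ {n}) using (_∈?_)
  open import Data.List.Relation.Unary.Any using (any?)

  length-allFin : length (allFin n) ≡ n
  length-allFin = length-tabulate (λ i → i)

  Unique⇒length≤n : {xs : List (Fin n)} → Unique xs → length xs ≤ n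
  Unique⇒length≤n {xs} xs! = subst (length xs ≤_) length-allFin (Unique-⊆⇒length≤ xs! (λ _ → ∈-allFin _))

  pigeonhole : {xs ys : List (Fin n)} → Unique xs → Unique ys → n < length xs + length ys →
               ∃ λ i → i ∈ xs × i ∈ ys
  pigeonhole {xs} {ys} xs! ys! long with any? (_∈? ys) xs
  ... | yes common = find common
  ... | no disjoint = ⊥-elim (<⇒≱ long (subst (_≤ n) (length-++ xs)
                                        (Unique⇒length≤n (Unique.++⁺ xs! ys! λ (i∈xs , i∈ys) → disjoint (lose i∈xs i∈ys)))))

  ∑-length-fibres : {A : Set} (f : A → Fin n) (xs : List A) →
                    ∑[ i ∈ allFin n ] length (filter (λ x → f x Fin.≟ i) xs) ≡ length xs
  ∑-length-fibres f [] = trans (∑-const (allFin n) 0) (*-zeroʳ (length (allFin n)))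
  ∑-length-fibres f (x ∷ xs) = begin
    ∑[ i ∈ allFin n ] length (filter (λ y → f y Fin.≟ i) (x ∷ xs))
      ≡⟨ ∑-cong (allFin n) (λ i → length-filter-∷ (λ y → f y Fin.≟ i) x xs) ⟩
    ∑[ i ∈ allFin n ] (𝟙 (f x Fin.≟ i) + length (filter (λ y → f y Fin.≟ i) xs))
      ≡⟨ ∑-distrib-+ (allFin n) _ _ ⟩
    ∑[ i ∈ allFin n ] 𝟙 (f x Fin.≟ i) + ∑[ i ∈ allFin n ] length (filter (λ y → f y Fin.≟ i) xs)
      ≡⟨ cong₂ _+_ (trans (∑-𝟙≡length-filter (f x Fin.≟_) (allFin n)) fibre-of-x) (∑-length-fibres f xs) ⟩
    suc (length xs) ∎
    where
    open ≡-Reasoning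
    fibre-of-x : length (filter (f x Fin.≟_) (allFin n)) ≡ 1
    fibre-of-x = length-filter-uniqueWitness (f x Fin.≟_) (Unique.allFin⁺ n) (∈-allFin (f x)) refl sym

module SumsetBounds {Carrier : Set} (_≟_ : DecidableEquality Carrier)
                    {_∙_ : Carrier → Carrier → Carrier} {ε : Carrier} {_⁻¹ : Carrier → Carrier}
                    (isAbelianGroup : IsAbelianGroup _≡_ _∙_ ε _⁻¹) where

  private
    abelianGroup : AbelianGroup 0ℓ 0ℓ
    abelianGroup = record { isAbelianGroup = isAbelianGroup }

  open AbelianGroup abelianGroup using (assoc; commutativeSemigroup)
  open import Algebra.Properties.AbelianGroup abelianGroup
  open import Algebra.Properties.CommutativeSemigroup commutativeSemigroup using (x∙yz≈y∙xz; xy∙z≈zy∙x)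
  open import Data.List.Membership.DecPropositional _≟_ using (_∈?_)
  open import Data.List.Relation.Unary.Any using (any?)

  _∔_⊆_ : List Carrier → List Carrier → List Carrier → Set
  X ∔ Y ⊆ Z = ∀ {x y} → x ∈ X → y ∈ Y → x ∙ y ∈ Z

  translate⊆⇒length≤ : ∀ {X Z} y → Unique X → (∀ {x} → x ∈ X → x ∙ y ∈ Z) → length X ≤ length Z
  translate⊆⇒length≤ {X} {Z} y X! X+y⊆Z = subst (_≤ length Z) (length-map (_∙ y) X)
    (Unique-⊆⇒length≤ (Unique.map⁺ (λ {a} {b} → ∙-cancelʳ y a b) X!) λ z∈X+y →
      let x , x∈X , z≡x∙y = ∈-map⁻ (_∙ y) z∈X+y in subst (_∈ Z) (sym z≡x∙y) (X+y⊆Z x∈X))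

  module DysonTransform (e : Carrier) (X Y : List Carrier) where

    kept? : Decidable (λ y → y ∙ e ∈ X)
    kept? y = (y ∙ e) ∈? X

    dropped X′ Y′ : List Carrier
    dropped = filter (∁? kept?) Y
    X′ = X ++ map (_∙ e) dropped
    Y′ = filter kept? Y

    Unique-X′ : Unique X → Unique Y → Unique X′
    Unique-X′ X! Y! = Unique.++⁺ X! (Unique.map⁺ (λ {a} {b} → ∙-cancelʳ e a b) (Unique.filter⁺ (∁? kept?) Y!)) disjoint
      where
      disjoint : Disjoint X (map (_∙ e) dropped)
      disjoint (z∈X , z∈Y+e) with ∈-map⁻ (_∙ e) z∈Y+e
      ... | y , y∈ , refl = proj₂ (∈-filter⁻ (∁? kept?) {xs = Y} y∈) z∈X

    Unique-Y′ : Unique Y → Unique Y′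
    Unique-Y′ = Unique.filter⁺ kept?

    length-X′+length-Y′ : length X′ + length Y′ ≡ length X + length Y
    length-X′+length-Y′ = begin
      length X′ + length Y′                                ≡⟨ cong (_+ length Y′) (length-++ X) ⟩
      length X + length (map (_∙ e) dropped) + length Y′ ≡⟨ cong (λ k → length X + k + length Y′) (length-map (_∙ e) dropped) ⟩
      length X + length dropped + length Y′               ≡⟨ +-assoc (length X) (length dropped) (length Y′) ⟩
      length X + (length dropped + length Y′)             ≡⟨ cong (length X +_) (+-comm (length dropped) (length Y′)) ⟩
      length X + (length Y′ + length dropped)             ≡⟨ cong (length X +_) (length-filter+length-filter-∁ kept? Y) ⟩
      length X + length Y                                 ∎
      where open ≡-Reasoning

    sums-preserved : ∀ {Z} → X ∔ Y ⊆ Z → X′ ∔ Y′ ⊆ Z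
    sums-preserved {Z} X+Y⊆Z {u} {v} u∈X′ v∈Y′ with ∈-++⁻ X u∈X′ | ∈-filter⁻ kept? v∈Y′
    ... | inj₁ u∈X | v∈Y , _ = X+Y⊆Z u∈X v∈Y
    ... | inj₂ u∈Y+e | _ , v+e∈X with ∈-map⁻ (_∙ e) u∈Y+e
    ...   | t , t∈ , refl = subst (_∈ Z) (xy∙z≈zy∙x v e t) (X+Y⊆Z v+e∈X (proj₁ (∈-filter⁻ (∁? kept?) t∈)))

  module _ (p : ℕ) (orbits-large : ∀ {X x d} → x ∈ X → d ≢ ε → (∀ {u} → u ∈ X → u ∙ d ∈ X) → p ≤ length X) where

    -- Induction on |Y|. If X is invariant under d = y₂ − y₁ it contains a whole orbit of d; otherwise some
    -- u ∈ X has u + d ∉ X, and the e-transform with e = u − y₁ keeps y₁ but drops y₂ from Y.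
    cauchyDavenport : ∀ {X Y Z x₀ y₀} → Unique X → Unique Y → x₀ ∈ X → y₀ ∈ Y → X ∔ Y ⊆ Z →
                      p ≤ length Z ⊎ length X + length Y ≤ suc (length Z)
    cauchyDavenport {Y = Y} = go (<-wellFounded (length Y))
      where
      go : ∀ {X Y Z x₀ y₀} → Acc _<_ (length Y) → Unique X → Unique Y → x₀ ∈ X → y₀ ∈ Y → X ∔ Y ⊆ Z →
           p ≤ length Z ⊎ length X + length Y ≤ suc (length Z)
      go {Y = []} _ _ _ _ () _
      go {X} {y₁ ∷ []} {Z} _ X! _ _ _ X+Y⊆Z =
        inj₂ (subst (_≤ suc (length Z)) (+-comm 1 (length X)) (s≤s (translate⊆⇒length≤ y₁ X! (λ x∈X → X+Y⊆Z x∈X (here refl)))))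
      go {X} {Y@(y₁ ∷ y₂ ∷ _)} {Z} {x₀} (acc smaller) X! Y!@((y₁≢y₂ ∷ _) ∷ _) x₀∈X _ X+Y⊆Z
        with any? (λ u → ¬? ((u ∙ (y₂ ∙ (y₁ ⁻¹))) ∈? X)) X
      ... | no invariant = inj₁ (≤-trans (orbits-large x₀∈X d≢ε X+d⊆X) (translate⊆⇒length≤ y₁ X! (λ x∈X → X+Y⊆Z x∈X (here refl))))
        where
        d = y₂ ∙ (y₁ ⁻¹)

        d≢ε : d ≢ ε
        d≢ε d≡ε = y₁≢y₂ (sym (x∙y⁻¹≈ε⇒x≈y y₂ y₁ d≡ε))

        X+d⊆X : ∀ {u} → u ∈ X → u ∙ d ∈ X
        X+d⊆X {u} u∈X = decidable-stable ((u ∙ d) ∈? X) (λ u+d∉X → invariant (lose u∈X u+d∉X))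
      ... | yes escape = map₂ (subst (_≤ suc (length Z)) length-X′+length-Y′)
                           (go (smaller Y′-shorter) (Unique-X′ X! Y!) (Unique-Y′ Y!) (∈-++⁺ˡ x₀∈X) y₁∈Y′ (sums-preserved X+Y⊆Z))
        where
        u = proj₁ (find escape)
        u∈X = proj₁ (proj₂ (find escape))
        u+d∉X = proj₂ (proj₂ (find escape))
        open DysonTransform (u ∙ (y₁ ⁻¹)) X Y

        y₁+e≡u : y₁ ∙ (u ∙ (y₁ ⁻¹)) ≡ u
        y₁+e≡u = trans (sym (assoc y₁ u (y₁ ⁻¹))) (xyx⁻¹≈y y₁ u)

        y₁∈Y′ : y₁ ∈ Y′
        y₁∈Y′ = ∈-filter⁺ kept? (here refl) (subst (_∈ X) (sym y₁+e≡u) u∈X)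

        Y′-shorter : length Y′ < length Y
        Y′-shorter = filter-notAll kept? Y (there (here λ y₂+e∈X → u+d∉X (subst (_∈ X) (x∙yz≈y∙xz y₂ u (y₁ ⁻¹)) y₂+e∈X)))

module _ {A : Set} {_∙_ : A → A → A} {ε : A} {_⁻¹ : A → A} where

  open import Algebra.Definitions {A = A} _≡_ using (Associative; Commutative; LeftIdentity; LeftInverse)

  isAbelianGroupˡ : Associative _∙_ → Commutative _∙_ → LeftIdentity ε _∙_ → LeftInverse ε _⁻¹ _∙_ →
                    IsAbelianGroup _≡_ _∙_ ε _⁻¹
  isAbelianGroupˡ assoc comm identityˡ inverseˡ = record
    { isGroup = record
      { isMonoid = record
        { isSemigroup = record { isMagma = isMagma _∙_ ; assoc = assoc }
        ; identity = comm∧idˡ⇒id comm identityˡ }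
      ; inverse = comm∧invˡ⇒inv comm inverseˡ
      ; ⁻¹-cong = cong _⁻¹ }
    ; comm = comm }

[m%n+o]%n≡[m+o]%n : ∀ m o n .{{_ : NonZero n}} → (m % n + o) % n ≡ (m + o) % n
[m%n+o]%n≡[m+o]%n m o n = begin
  (m % n + o) % n         ≡⟨ %-distribˡ-+ (m % n) o n ⟩
  (m % n % n + o % n) % n ≡⟨ cong (λ k → (k + o % n) % n) (m%n%n≡m%n m n) ⟩
  (m % n + o % n) % n     ≡⟨ %-distribˡ-+ m o n ⟨
  (m + o) % n             ∎
  where open ≡-Reasoning

[m+o%n]%n≡[m+o]%n : ∀ m o n .{{_ : NonZero n}} → (m + o % n) % n ≡ (m + o) % n
[m+o%n]%n≡[m+o]%n m o n = begin
  (m + o % n) % n ≡⟨ cong (_% n) (+-comm m (o % n)) ⟩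
  (o % n + m) % n ≡⟨ [m%n+o]%n≡[m+o]%n o m n ⟩
  (o + m) % n     ≡⟨ cong (_% n) (+-comm o m) ⟩
  (m + o) % n     ∎
  where open ≡-Reasoning

m%n≡o%n⇒n∣o∸m : ∀ {m o} n .{{_ : NonZero n}} → m % n ≡ o % n → n ∣ o ∸ m
m%n≡o%n⇒n∣o∸m {m} {o} n eq = divides (o / n ∸ m / n) (begin
  o ∸ m                                   ≡⟨ cong₂ _∸_ (m≡m%n+[m/n]*n o n) (m≡m%n+[m/n]*n m n) ⟩
  (o % n + o / n * n) ∸ (m % n + m / n * n) ≡⟨ cong (λ k → (o % n + o / n * n) ∸ (k + m / n * n)) eq ⟩
  (o % n + o / n * n) ∸ (o % n + m / n * n) ≡⟨ [m+n]∸[m+o]≡n∸o (o % n) (o / n * n) (m / n * n) ⟩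
  o / n * n ∸ m / n * n                   ≡⟨ *-distribʳ-∸ n (o / n) (m / n) ⟨
  (o / n ∸ m / n) * n                     ∎)
  where open ≡-Reasoning

module _ {p : ℕ} .{{_ : NonZero p}} where

  -p_ : Fin p → Fin p
  -p a = (p ∸ toℕ a) mod p

  toℕ-mod : ∀ n → toℕ (n mod p) ≡ n % p
  toℕ-mod n = Fin.toℕ-fromℕ< _

  toℕ-0F : toℕ (0F p) ≡ 0
  toℕ-0F = trans (toℕ-mod 0) (m<n⇒m%n≡m (>-nonZero⁻¹ p))

  toℕ≡0⇒≡0F : ∀ {a} → toℕ a ≡ 0 → a ≡ 0F p
  toℕ≡0⇒≡0F a≡0 = Fin.toℕ-injective (trans a≡0 (sym toℕ-0F))

  toℕ-+p : ∀ a b → toℕ (a +p b) ≡ (toℕ a + toℕ b) % p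
  toℕ-+p a b = toℕ-mod (toℕ a + toℕ b)

  -- Stated in the shape x + i * d of an arithmetic progression.
  toℕ-+p-self : ∀ a → toℕ (a +p a) ≡ (0 + toℕ a * 2) % p
  toℕ-+p-self a = trans (toℕ-+p a a) (cong (_% p) (trans (cong (toℕ a +_) (sym (+-identityʳ (toℕ a)))) (*-comm 2 (toℕ a))))

  toℕ-fold-+p : ∀ a d j → toℕ (fold a (_+p d) j) ≡ (toℕ a + j * toℕ d) % p
  toℕ-fold-+p a d zero = trans (sym (m<n⇒m%n≡m (Fin.toℕ<n a))) (cong (_% p) (sym (+-identityʳ (toℕ a))))
  toℕ-fold-+p a d (suc j) = begin
    toℕ (fold a (_+p d) j +p d)                   ≡⟨ toℕ-+p (fold a (_+p d) j) d ⟩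
    (toℕ (fold a (_+p d) j) + toℕ d) % p          ≡⟨ cong (λ k → (k + toℕ d) % p) (toℕ-fold-+p a d j) ⟩
    ((toℕ a + j * toℕ d) % p + toℕ d) % p         ≡⟨ [m%n+o]%n≡[m+o]%n (toℕ a + j * toℕ d) (toℕ d) p ⟩
    (toℕ a + j * toℕ d + toℕ d) % p               ≡⟨ cong (_% p) (+-assoc (toℕ a) (j * toℕ d) (toℕ d)) ⟩
    (toℕ a + (j * toℕ d + toℕ d)) % p             ≡⟨ cong (λ k → (toℕ a + k) % p) (+-comm (j * toℕ d) (toℕ d)) ⟩
    (toℕ a + suc j * toℕ d) % p                   ∎
    where open ≡-Reasoning

  +p-comm : ∀ a b → a +p b ≡ b +p a
  +p-comm a b = cong (_mod p) (+-comm (toℕ a) (toℕ b))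

  +p-assoc : ∀ a b c → (a +p b) +p c ≡ a +p (b +p c)
  +p-assoc a b c = Fin.toℕ-injective (begin
    toℕ ((a +p b) +p c)               ≡⟨ toℕ-+p (a +p b) c ⟩
    (toℕ (a +p b) + toℕ c) % p        ≡⟨ cong (λ k → (k + toℕ c) % p) (toℕ-+p a b) ⟩
    ((toℕ a + toℕ b) % p + toℕ c) % p ≡⟨ [m%n+o]%n≡[m+o]%n (toℕ a + toℕ b) (toℕ c) p ⟩
    (toℕ a + toℕ b + toℕ c) % p       ≡⟨ cong (_% p) (+-assoc (toℕ a) (toℕ b) (toℕ c)) ⟩
    (toℕ a + (toℕ b + toℕ c)) % p     ≡⟨ [m+o%n]%n≡[m+o]%n (toℕ a) (toℕ b + toℕ c) p ⟨
    (toℕ a + (toℕ b + toℕ c) % p) % p ≡⟨ cong (λ k → (toℕ a + k) % p) (toℕ-+p b c) ⟨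
    (toℕ a + toℕ (b +p c)) % p        ≡⟨ toℕ-+p a (b +p c) ⟨
    toℕ (a +p (b +p c))               ∎)
    where open ≡-Reasoning

  +p-identityˡ : ∀ a → 0F p +p a ≡ a
  +p-identityˡ a = Fin.toℕ-injective (begin
    toℕ (0F p +p a)             ≡⟨ toℕ-+p (0F p) a ⟩
    (toℕ (0F p) + toℕ a) % p    ≡⟨ cong (λ k → (k + toℕ a) % p) toℕ-0F ⟩
    toℕ a % p                   ≡⟨ m<n⇒m%n≡m (Fin.toℕ<n a) ⟩
    toℕ a                       ∎)
    where open ≡-Reasoning

  +p-inverseˡ : ∀ a → (-p a) +p a ≡ 0F p
  +p-inverseˡ a = Fin.toℕ-injective (begin
    toℕ ((-p a) +p a)             ≡⟨ toℕ-+p (-p a) a ⟩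
    (toℕ (-p a) + toℕ a) % p      ≡⟨ cong (λ k → (k + toℕ a) % p) (toℕ-mod (p ∸ toℕ a)) ⟩
    ((p ∸ toℕ a) % p + toℕ a) % p ≡⟨ [m%n+o]%n≡[m+o]%n (p ∸ toℕ a) (toℕ a) p ⟩
    (p ∸ toℕ a + toℕ a) % p       ≡⟨ cong (_% p) (m∸n+n≡m (<⇒≤ (Fin.toℕ<n a))) ⟩
    p % p                         ≡⟨ n%n≡0 p ⟩
    0                             ≡⟨ toℕ-0F ⟨
    toℕ (0F p)                    ∎)
    where open ≡-Reasoning

  +p-isAbelianGroup : IsAbelianGroup _≡_ _+p_ (0F p) -p_
  +p-isAbelianGroup = isAbelianGroupˡ +p-assoc +p-comm +p-identityˡ +p-inverseˡ

  +p-abelianGroup : AbelianGroup 0ℓ 0ℓ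
  +p-abelianGroup = record { isAbelianGroup = +p-isAbelianGroup }

  ⊕-isAbelianGroup : IsAbelianGroup _≡_ _⊕_ 0G ⊖_
  ⊕-isAbelianGroup = isAbelianGroupˡ
    (λ (a , b) (c , d) (e , f) → cong₂ _,_ (+p-assoc a c e) (+p-assoc b d f))
    (λ (a , b) (c , d) → cong₂ _,_ (+p-comm a c) (+p-comm b d))
    (λ (a , b) → cong₂ _,_ (+p-identityˡ a) (+p-identityˡ b))
    (λ (a , b) → cong₂ _,_ (+p-inverseˡ a) (+p-inverseˡ b))

fold-hom : ∀ {A B : Set} (f : A → B) {s : A → A} {t : B → B} → (∀ u → f (s u) ≡ t (f u)) →
           ∀ z n → f (fold z s n) ≡ fold (f z) t n
fold-hom f f∘s≗t∘f z zero = refl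
fold-hom f {s} {t} f∘s≗t∘f z (suc n) = trans (f∘s≗t∘f (fold z s n)) (cong t (fold-hom f f∘s≗t∘f z n))

module _ {p : ℕ} .{{_ : NonZero p}} (p-prime : Prime p) where

  progression-distinct : ∀ x {d i j} → 0 < d → d < p → i < j → j < p → (x + i * d) % p ≢ (x + j * d) % p
  progression-distinct x {d} {i} {j} 0<d d<p i<j j<p eq with euclidsLemma (j ∸ i) d p-prime p∣[j∸i]*d
    where
    p∣[j∸i]*d : p ∣ (j ∸ i) * d
    p∣[j∸i]*d = subst (p ∣_) (trans ([m+n]∸[m+o]≡n∸o x (j * d) (i * d)) (sym (*-distribʳ-∸ d j i)))
                  (m%n≡o%n⇒n∣o∸m p eq)
  ... | inj₁ p∣j∸i = >⇒∤ {{>-nonZero (m<n⇒0<n∸m i<j)}} (≤-<-trans (m∸n≤m j i) j<p) p∣j∸i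
  ... | inj₂ p∣d = >⇒∤ {{>-nonZero 0<d}} d<p p∣d

  fold-+p-distinct : ∀ a {d} → toℕ d ≢ 0 → ∀ {i j} → i < j → j < p → fold a (_+p d) i ≢ fold a (_+p d) j
  fold-+p-distinct a {d} d≢0 {i} {j} i<j j<p eq = progression-distinct (toℕ a) (n≢0⇒n>0 d≢0) (Fin.toℕ<n d) i<j j<p
    (trans (sym (toℕ-fold-+p a d i)) (trans (cong toℕ eq) (toℕ-fold-+p a d j)))

  progression-injective : ∀ x {d i j} → 0 < d → d < p → i < p → j < p → (x + i * d) % p ≡ (x + j * d) % p → i ≡ j
  progression-injective x 0<d d<p i<p j<p eq with <-cmp _ _
  ... | tri< i<j _ _ = ⊥-elim (progression-distinct x 0<d d<p i<j j<p eq)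
  ... | tri≈ _ i≡j _ = i≡j
  ... | tri> _ _ j<i = ⊥-elim (progression-distinct x 0<d d<p j<i i<p (sym eq))

  +p-double-injective : 2 < p → ∀ {a b} → a +p a ≡ b +p b → a ≡ b
  +p-double-injective 2<p {a} {b} eq = Fin.toℕ-injective (progression-injective 0 (s≤s z≤n) 2<p (Fin.toℕ<n a) (Fin.toℕ<n b)
    (trans (sym (toℕ-+p-self a)) (trans (cong toℕ eq) (toℕ-+p-self b))))

  ⊕-orbit-large : ∀ {X x d} → x ∈ X → d ≢ 0G → (∀ {u} → u ∈ X → u ⊕ d ∈ X) → p ≤ length X
  ⊕-orbit-large {X} {x} {d} x∈X d≢0 X+d⊆X =
    subst (_≤ length X) (length-applyUpTo orbit p) (Unique-⊆⇒length≤ (Unique.applyUpTo⁺₁ orbit p distinct) orbit⊆X)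
    where
    orbit : ℕ → G p
    orbit = fold x (_⊕ d)

    orbit∈X : ∀ j → orbit j ∈ X
    orbit∈X zero = x∈X
    orbit∈X (suc j) = X+d⊆X (orbit∈X j)

    orbit⊆X : applyUpTo orbit p ⊆ X
    orbit⊆X z∈ with ∈-applyUpTo⁻ orbit z∈
    ... | j , _ , refl = orbit∈X j

    distinct : ∀ {i j} → i < j → j < p → orbit i ≢ orbit j
    distinct {i} {j} i<j j<p eq with toℕ (proj₁ d) ℕ.≟ 0 | toℕ (proj₂ d) ℕ.≟ 0
    ... | no d₁≢0 | _ = fold-+p-distinct (proj₁ x) d₁≢0 i<j j<p
                          (trans (sym (fold-hom proj₁ (λ _ → refl) x i)) (trans (cong proj₁ eq) (fold-hom proj₁ (λ _ → refl) x j)))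
    ... | yes _ | no d₂≢0 = fold-+p-distinct (proj₂ x) d₂≢0 i<j j<p
                          (trans (sym (fold-hom proj₂ (λ _ → refl) x i)) (trans (cong proj₂ eq) (fold-hom proj₂ (λ _ → refl) x j)))
    ... | yes d₁≡0 | yes d₂≡0 = d≢0 (cong₂ _,_ (toℕ≡0⇒≡0F d₁≡0) (toℕ≡0⇒≡0F d₂≡0))

  -- Discarding the at most one j with j + j = i leaves a set U with |U| > p/2, so U meets i − U.
  every-element-sum-of-distinct : 2 < p → ∀ {N n} → Unique N → suc n ≤ length N → p < 2 * n →
                                  ∀ i → ∃₂ λ j k → j ∈ N × k ∈ N × j ≢ k × j +p k ≡ i
  every-element-sum-of-distinct 2<p {N} {n} N! n<|N| p<2n i =
    let k , k∈U , k∈i-U = pigeonhole U! (Unique.map⁺ i-_-injective U!) p<|U|+|i-U|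
        j , j∈U , k≡i-j = ∈-map⁻ (i -_) k∈i-U
        j+k≡i = trans (cong (j +p_) k≡i-j) (j+[i-j]≡i j)
    in j , k , proj₁ (∈-filter⁻ (∁? halves?) {xs = N} j∈U) , proj₁ (∈-filter⁻ (∁? halves?) {xs = N} k∈U)
         , (λ j≡k → proj₂ (∈-filter⁻ (∁? halves?) {xs = N} j∈U) (trans (cong (j +p_) j≡k) j+k≡i)) , j+k≡i
    where
    open AbelianGroup +p-abelianGroup using (inverseʳ; identityʳ)
    open import Algebra.Properties.AbelianGroup +p-abelianGroup using (∙-cancelˡ; ⁻¹-injective)
    open import Algebra.Properties.CommutativeSemigroup (AbelianGroup.commutativeSemigroup +p-abelianGroup) using (x∙yz≈y∙xz)

    _-_ : Fin p → Fin p → Fin p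
    a - b = a +p (-p b)

    i-_-injective : ∀ {a b} → i - a ≡ i - b → a ≡ b
    i-_-injective eq = ⁻¹-injective (∙-cancelˡ i _ _ eq)

    j+[i-j]≡i : ∀ j → j +p (i - j) ≡ i
    j+[i-j]≡i j = trans (x∙yz≈y∙xz j i (-p j)) (trans (cong (i +p_) (inverseʳ j)) (identityʳ i))

    halves? : ∀ j → Dec (j +p j ≡ i)
    halves? j = (j +p j) Fin.≟ i

    U : List (Fin p)
    U = filter (∁? halves?) N

    U! : Unique U
    U! = Unique.filter⁺ (∁? halves?) N!

    at-most-one-half : length (filter halves? N) ≤ 1
    at-most-one-half = Unique-constant⇒length≤1 (Unique.filter⁺ halves? N!) λ j∈ k∈ →
      +p-double-injective 2<p (trans (proj₂ (∈-filter⁻ halves? {xs = N} j∈)) (sym (proj₂ (∈-filter⁻ halves? {xs = N} k∈))))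

    n≤|U| : n ≤ length U
    n≤|U| = ≤-pred (begin
      suc n                                   ≤⟨ n<|N| ⟩
      length N                                ≡⟨ length-filter+length-filter-∁ halves? N ⟨
      length (filter halves? N) + length U    ≤⟨ +-monoˡ-≤ (length U) at-most-one-half ⟩
      suc (length U)                          ∎)
      where open ≤-Reasoning

    p<|U|+|i-U| : p < length U + length (map (i -_) U)
    p<|U|+|i-U| = begin-strict
      p                           <⟨ p<2n ⟩
      2 * n                       ≤⟨ *-monoʳ-≤ 2 n≤|U| ⟩
      length U + (length U + 0)   ≡⟨ cong (length U +_) (trans (+-identityʳ (length U)) (sym (length-map (i -_) U))) ⟩
      length U + length (map (i -_) U) ∎
      where open ≤-Reasoning

module Layers {p : ℕ} .{{_ : NonZero p}} (p-prime : Prime p) (A : List (G p)) (A! : Unique A)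
              (idx : G p → Fin p) (idx-hom : ∀ x y → idx (x ⊕ y) ≡ idx x +p idx y) where

  open SumsetBounds _≟G_ ⊕-isAbelianGroup using (translate⊆⇒length≤; cauchyDavenport)

  A⟨_⟩ 2^A⟨_⟩ : Fin p → List (G p)
  A⟨_⟩ = layer A idx
  2^A⟨_⟩ = layer (restrictedSumset A) idx

  ∈-layer⁻ : ∀ {i x} → x ∈ A⟨ i ⟩ → x ∈ A × idx x ≡ i
  ∈-layer⁻ = ∈-filter⁻ _

  layers-disjoint : ∀ {i j x y} → i ≢ j → x ∈ A⟨ i ⟩ → y ∈ A⟨ j ⟩ → x ≢ y
  layers-disjoint i≢j x∈ y∈ refl = i≢j (trans (sym (proj₂ (∈-layer⁻ x∈))) (proj₂ (∈-layer⁻ y∈)))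

  sum∈2^A⟨+⟩ : ∀ {i j x y} → x ∈ A⟨ i ⟩ → y ∈ A⟨ j ⟩ → x ≢ y → x ⊕ y ∈ 2^A⟨ i +p j ⟩
  sum∈2^A⟨+⟩ x∈ y∈ x≢y with ∈-layer⁻ x∈ | ∈-layer⁻ y∈
  ... | x∈A , refl | y∈A , refl =
    ∈-filter⁺ _ (∈-filter⁺ _ (∈-cartesianProduct⁺ (∈-allFin _) (∈-allFin _)) (lose x∈A (lose y∈A (x≢y , refl)))) (idx-hom _ _)

  same-layer-bound : ∀ i → length A⟨ i ⟩ ≤ suc (length 2^A⟨ i +p i ⟩)
  same-layer-bound i = bound (Unique.filter⁺ _ A!) id
    where
    bound : ∀ {xs} → Unique xs → xs ⊆ A⟨ i ⟩ → length xs ≤ suc (length 2^A⟨ i +p i ⟩)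
    bound {[]} _ _ = z≤n
    bound {x ∷ xs} (x∉xs ∷ xs!) xs⊆ = s≤s (translate⊆⇒length≤ x xs! λ y∈xs →
      sum∈2^A⟨+⟩ (xs⊆ (there y∈xs)) (xs⊆ (here refl)) (≢-sym (All.lookup x∉xs y∈xs)))

  distinct-layers-bound : ∀ {i j x y} → i ≢ j → x ∈ A⟨ i ⟩ → y ∈ A⟨ j ⟩ →
                          p ≤ length 2^A⟨ i +p j ⟩ ⊎ length A⟨ i ⟩ + length A⟨ j ⟩ ≤ suc (length 2^A⟨ i +p j ⟩)
  distinct-layers-bound i≢j x∈ y∈ = cauchyDavenport p (⊕-orbit-large p-prime)
    (Unique.filter⁺ _ A!) (Unique.filter⁺ _ A!) x∈ y∈ λ u∈ v∈ → sum∈2^A⟨+⟩ u∈ v∈ (layers-disjoint i≢j u∈ v∈)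

  nonempty? : ∀ i → Dec (0 < length A⟨ i ⟩)
  nonempty? i = 0 <? length A⟨ i ⟩

  nonzero∧nonempty? : ∀ i → Dec (toℕ i ≢ 0 × 0 < length A⟨ i ⟩)
  nonzero∧nonempty? i = ¬? (toℕ i ℕ.≟ 0) ×-dec nonempty? i

  nonempty-layers : List (Fin p)
  nonempty-layers = filter nonempty? (allFin p)

  nonemptyCount<length-nonempty-layers : 0 < length A⟨ 0F p ⟩ → nonemptyCount A idx < length nonempty-layers
  nonemptyCount<length-nonempty-layers A⟨0⟩≢[] = Unique-⊆⇒length≤ 0∷nonzero! 0∷nonzero⊆nonempty
    where
    nonzero-layers : List (Fin p)
    nonzero-layers = filter nonzero∧nonempty? (allFin p)

    0∷nonzero! : Unique (0F p ∷ nonzero-layers)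
    0∷nonzero! = All.tabulate (λ i∈ 0≡i → proj₁ (proj₂ (∈-filter⁻ nonzero∧nonempty? {xs = allFin p} i∈)) (trans (cong toℕ (sym 0≡i)) toℕ-0F))
               ∷ Unique.filter⁺ nonzero∧nonempty? (Unique.allFin⁺ p)

    0∷nonzero⊆nonempty : 0F p ∷ nonzero-layers ⊆ nonempty-layers
    0∷nonzero⊆nonempty (here refl) = ∈-filter⁺ nonempty? (∈-allFin _) A⟨0⟩≢[]
    0∷nonzero⊆nonempty (there i∈) = ∈-filter⁺ nonempty? (∈-allFin _) (proj₂ (proj₂ (∈-filter⁻ nonzero∧nonempty? {xs = allFin p} i∈)))

  every-layer-of-2^A-nonempty : 2 < p → 0 < length A⟨ 0F p ⟩ → p < 2 * nonemptyCount A idx → ∀ i → 0 < length 2^A⟨ i ⟩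
  every-layer-of-2^A-nonempty 2<p A⟨0⟩≢[] p<2m i =
    let j , k , j∈ , k∈ , j≢k , j+k≡i = every-element-sum-of-distinct p-prime 2<p (Unique.filter⁺ nonempty? (Unique.allFin⁺ p))
                                           (nonemptyCount<length-nonempty-layers A⟨0⟩≢[]) p<2m i
        x , x∈ = 0<length⇒∃∈ (proj₂ (∈-filter⁻ nonempty? {xs = allFin p} j∈))
        y , y∈ = 0<length⇒∃∈ (proj₂ (∈-filter⁻ nonempty? {xs = allFin p} k∈))
    in subst (λ l → 0 < length 2^A⟨ l ⟩) j+k≡i (∈-length (sum∈2^A⟨+⟩ x∈ y∈ (layers-disjoint j≢k x∈ y∈)))

  length≤p*max : ∀ {c} → (∀ i → length A⟨ i ⟩ ≤ c) → length A ≤ p * c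
  length≤p*max {c} ≤c = subst₂ _≤_ (∑-length-fibres idx A) (trans (∑-const (allFin p) c) (cong (_* c) (length-allFin {p})))
                                   (∑-mono-≤ (allFin p) ≤c)

  ∑-𝟙-zero : ∑[ i ∈ allFin p ] 𝟙 (toℕ i ℕ.≟ 0) ≡ 1
  ∑-𝟙-zero = trans (∑-𝟙≡length-filter (λ i → toℕ i ℕ.≟ 0) (allFin p))
    (length-filter-uniqueWitness (λ i → toℕ i ℕ.≟ 0) (Unique.allFin⁺ p) (∈-allFin (0F p)) toℕ-0F
      toℕ≡0⇒≡0F)

  3≤|A⟨0⟩| : length A ≡ 2 * p + 1 → (∀ i → length A⟨ i ⟩ ≤ length A⟨ 0F p ⟩) → 3 ≤ length A⟨ 0F p ⟩
  3≤|A⟨0⟩| |A|≡2p+1 maximal = ≮⇒≥ λ a<3 →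
    <⇒≱ 2p<|A| (≤-trans (length≤p*max maximal) (*-monoʳ-≤ p (≤-pred a<3)))
    where
    2p<|A| : p * 2 < length A
    2p<|A| = subst₂ _<_ (*-comm 2 p) (trans (+-comm 1 (2 * p)) (sym |A|≡2p+1)) (n<1+n (2 * p))

  module _ (2<p : 2 < p) (maximal : ∀ i → length A⟨ i ⟩ ≤ length A⟨ 0F p ⟩) (4≤a : 4 ≤ length A⟨ 0F p ⟩)
           (2a≤p+1 : 2 * length A⟨ 0F p ⟩ ≤ p + 1) (p<2m : p < 2 * nonemptyCount A idx) where

    0<a : 0 < length A⟨ 0F p ⟩
    0<a = ≤-trans (s≤s z≤n) 4≤a

    a+3≤p : length A⟨ 0F p ⟩ + 3 ≤ p
    a+3≤p = +-cancelʳ-≤ 1 _ _ (begin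
      a + 3 + 1 ≡⟨ +-assoc a 3 1 ⟩
      a + 4     ≤⟨ +-monoʳ-≤ a 4≤a ⟩
      a + a     ≡⟨ cong (a +_) (+-identityʳ a) ⟨
      2 * a     ≤⟨ 2a≤p+1 ⟩
      p + 1     ∎)
      where
      open ≤-Reasoning
      a = length A⟨ 0F p ⟩

    -- Weights chosen so that summing over i gives |A| + 2m + p ≤ |2̂A| + 2.
    layer-contribution : ∀ i (zero? : Dec (toℕ i ≡ 0)) (nonempty : Dec (0 < length A⟨ i ⟩)) →
                         length A⟨ i ⟩ + (2 * 𝟙 (¬? zero? ×-dec nonempty) + 1) ≤ length 2^A⟨ i ⟩ + 2 * 𝟙 zero?
    layer-contribution i (yes i≡0) _ =
      ≤-trans (+-monoˡ-≤ 1 (subst (λ k → length A⟨ i ⟩ ≤ suc (length 2^A⟨ k ⟩)) i+i≡i (same-layer-bound i)))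
              (≤-reflexive (sym (+-suc (length 2^A⟨ i ⟩) 1)))
      where
      i+i≡i : i +p i ≡ i
      i+i≡i = trans (cong (_+p i) (toℕ≡0⇒≡0F i≡0)) (+p-identityˡ i)
    layer-contribution i (no i≢0) (yes A⟨i⟩≢[]) = ≤-trans mixed-bound (≤-reflexive (sym (+-identityʳ _)))
      where
      a = length A⟨ 0F p ⟩
      b = length A⟨ i ⟩
      r = length 2^A⟨ i ⟩

      0≢i : 0F p ≢ i
      0≢i 0≡i = i≢0 (trans (cong toℕ (sym 0≡i)) toℕ-0F)

      mixed-bound : b + 3 ≤ r
      mixed-bound with subst (λ k → p ≤ length 2^A⟨ k ⟩ ⊎ a + b ≤ suc (length 2^A⟨ k ⟩)) (+p-identityˡ i)
                             (distinct-layers-bound 0≢i (proj₂ (0<length⇒∃∈ 0<a)) (proj₂ (0<length⇒∃∈ A⟨i⟩≢[])))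
      ... | inj₁ p≤r = ≤-trans (+-monoˡ-≤ 3 (maximal i)) (≤-trans a+3≤p p≤r)
      ... | inj₂ a+b≤1+r = ≤-pred (begin
        suc (b + 3) ≡⟨ +-suc b 3 ⟨
        b + 4       ≤⟨ +-monoʳ-≤ b 4≤a ⟩
        b + a       ≡⟨ +-comm b a ⟩
        a + b       ≤⟨ a+b≤1+r ⟩
        suc r       ∎)
        where open ≤-Reasoning
    layer-contribution i (no i≢0) (no A⟨i⟩≡[]) =
      subst₂ (λ b r → b + 1 ≤ r) (sym (n≤0⇒n≡0 (≮⇒≥ A⟨i⟩≡[]))) (sym (+-identityʳ _))
             (every-layer-of-2^A-nonempty 2<p 0<a p<2m i)

    4p≤|2^A| : length A ≡ 2 * p + 1 → 4 * p ≤ length (restrictedSumset A)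
    4p≤|2^A| |A|≡2p+1 = +-cancelʳ-≤ 2 (4 * p) r (begin
      4 * p + 2                                                            ≡⟨ 4p+2≡[2p+1]+[1+p+p] p ⟩
      2 * p + 1 + (suc p + p)                                              ≤⟨ +-monoʳ-≤ (2 * p + 1) (+-monoˡ-≤ p p<2m) ⟩
      2 * p + 1 + (2 * m + p)                                              ≡⟨ cong (_+ (2 * m + p)) |A|≡2p+1 ⟨
      length A + (2 * m + p)                                               ≡⟨ ∑-layer-weights ⟨
      ∑[ i ∈ allFin p ] (length A⟨ i ⟩ + (2 * 𝟙 (nonzero∧nonempty? i) + 1)) ≤⟨ ∑-mono-≤ (allFin p) (λ i → layer-contribution i (toℕ i ℕ.≟ 0) (nonempty? i)) ⟩
      ∑[ i ∈ allFin p ] (length 2^A⟨ i ⟩ + 2 * 𝟙 (toℕ i ℕ.≟ 0))           ≡⟨ ∑-sumset-layers ⟩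
      r + 2                                                                ∎)
      where
      open ≤-Reasoning
      m = nonemptyCount A idx
      r = length (restrictedSumset A)

      4p+2≡[2p+1]+[1+p+p] : ∀ p → 4 * p + 2 ≡ 2 * p + 1 + (suc p + p)
      4p+2≡[2p+1]+[1+p+p] = solve 1 (λ p → con 4 :* p :+ con 2 := con 2 :* p :+ con 1 :+ (con 1 :+ p :+ p)) refl
        where open +-*-Solver

      ∑-layer-weights : ∑[ i ∈ allFin p ] (length A⟨ i ⟩ + (2 * 𝟙 (nonzero∧nonempty? i) + 1)) ≡ length A + (2 * m + p)
      ∑-layer-weights = begin-equality
        ∑[ i ∈ allFin p ] (length A⟨ i ⟩ + (2 * 𝟙 (nonzero∧nonempty? i) + 1))
          ≡⟨ ∑-distrib-+ (allFin p) _ _ ⟩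
        ∑[ i ∈ allFin p ] length A⟨ i ⟩ + ∑[ i ∈ allFin p ] (2 * 𝟙 (nonzero∧nonempty? i) + 1)
          ≡⟨ cong₂ _+_ (∑-length-fibres idx A) (∑-distrib-+ (allFin p) _ _) ⟩
        length A + (∑[ i ∈ allFin p ] (2 * 𝟙 (nonzero∧nonempty? i)) + ∑[ i ∈ allFin p ] 1)
          ≡⟨ cong (length A +_) (cong₂ _+_ (trans (*-distribˡ-∑ (allFin p) 2 _) (cong (2 *_) (∑-𝟙≡length-filter nonzero∧nonempty? (allFin p))))
                                           (trans (∑-const (allFin p) 1) (trans (*-identityʳ _) (length-allFin {p})))) ⟩
        length A + (2 * m + p) ∎

      ∑-sumset-layers : ∑[ i ∈ allFin p ] (length 2^A⟨ i ⟩ + 2 * 𝟙 (toℕ i ℕ.≟ 0)) ≡ r + 2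
      ∑-sumset-layers = trans (∑-distrib-+ (allFin p) _ _)
        (cong₂ _+_ (∑-length-fibres idx (restrictedSumset A)) (trans (*-distribˡ-∑ (allFin p) 2 _) (cong (2 *_) ∑-𝟙-zero)))

lemma2p2 : (p : ℕ) .{{_ : NonZero p}} → Prime p → 5 ≤ p →
           (A : List (G p)) → Unique A → length A ≡ 2 * p + 1 →
           (H : List (G p)) → Unique H → length H ≡ p →
           0G ∈ H → (∀ x y → x ∈ H → y ∈ H → (x ⊕ y) ∈ H) → (∀ x → x ∈ H → (⊖ x) ∈ H) →
           (idx : G p → Fin p) →
           (∀ x y → idx (x ⊕ y) ≡ idx x +p idx y) →
           (∀ i → ∃ λ x → idx x ≡ i) →
           (∀ x → (x ∈ H → idx x ≡ 0F p) × (idx x ≡ 0F p → x ∈ H)) →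
           (∀ i → length (layer A idx i) ≤ length (layer A idx (0F p))) →
           2 * length (layer A idx (0F p)) ≤ p + 1 →
           p + 1 ≤ 2 * nonemptyCount A idx →
           length (restrictedSumset A) < 4 * p →
           length (layer A idx (0F p)) ≡ 3
lemma2p2 p p-prime 5≤p A A! |A|≡2p+1 _ _ _ _ _ _ idx idx-hom _ _ maximal 2a≤p+1 p+1≤2m |2^A|<4p =
  ≤-antisym (≮⇒≥ λ 3<a → <⇒≱ |2^A|<4p (4p≤|2^A| 2<p maximal 3<a 2a≤p+1 p<2m |A|≡2p+1))
            (3≤|A⟨0⟩| |A|≡2p+1 maximal)
  where
  open Layers p-prime A A! idx idx-hom

  2<p : 2 < p
  2<p = ≤-trans (s≤s (s≤s (s≤s z≤n))) 5≤p

  p<2m : p < 2 * nonemptyCount A idx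
  p<2m = subst (_≤ 2 * nonemptyCount A idx) (+-comm p 1) p+1≤2m
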